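{- For every integer $n\ge 4$, $\{0,1,\ldots,n\}\subseteq\mathcal{R}(n,1)$.
   Context: Consider words over the alphabet $\{A,\overline{A}\}$, where $A$ and $\overline{A}$ are complements. A plane tree is a rooted tree embedded in the plane with root on top, children ordered left to right; its half edges are ordered by starting at the root and tracing the perimeter counterclockwise, touching each side of each edge once. For a word $w=w[1]\cdots w[2n]$ and plane tree $T$ with $n$ edges, label the $i$-th half edge by $w[i]$; $T$ is $w$-valid if the two labels of every edge are complements. $\mathcal{R}(n,1)$ is the set of integers $k\ge 0$ such that some word of length $2n$ over $\{A,\overline{A}\}$ has exactly $k$ valid plane trees. -}

module Defs where

open import Data.Nat using (ℕ; zero; suc; _+_; _*_)
open import Data.List using (List; []; _∷_)
open import Data.Maybe using (Maybe; just; nothing)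
open import Data.Vec using (Vec; toList)
open import Data.Fin using (Fin)
open import Data.Product using (Σ; _×_)
open import Relation.Binary.PropositionalEquality using (_≡_)
open import Function.Bundles using (_↔_)

data Letter : Set where
  A  : Letter
  Ā  : Letter

data PlaneTree : Set where
  node : List PlaneTree → PlaneTree

mutual
  edges : PlaneTree → ℕ
  edges (node ts) = edgesF ts

  edgesF : List PlaneTree → ℕ
  edgesF []       = 0
  edgesF (t ∷ ts) = suc (edges t + edgesF ts)

-- Labelling half edges along the counterclockwise perimeter walk from
-- the root: for each child edge (left to right) we first traverse its
-- left side going down (reading one letter), then the subtree below,
-- then its right side going up (reading one letter).  The two letters
-- read on an edge must be complements.  `validF ts w` consumes a prefix
-- of w and returns the remaining suffix, or fails (nothing) if some
-- edge is not complementary or the word runs out.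
mutual
  validT : PlaneTree → List Letter → Maybe (List Letter)
  validT (node ts) w = validF ts w

  validF : List PlaneTree → List Letter → Maybe (List Letter)
  validF []       w       = just w
  validF (t ∷ ts) []      = nothing
  validF (t ∷ ts) (a ∷ w) with validT t w
  ... | nothing = nothing
  ... | just []        = nothing
  ... | just (b ∷ w′)  = checkEdge a b (validF ts w′)

  checkEdge : Letter → Letter → Maybe (List Letter) → Maybe (List Letter)
  checkEdge A Ā r = r
  checkEdge Ā A r = r
  checkEdge _ _ r = nothing

Valid : {n : ℕ} → PlaneTree → Vec Letter (2 * n) → Set
Valid t w = validT t (toList w) ≡ just []

ValidTrees : (n : ℕ) → Vec Letter (2 * n) → Set
ValidTrees n w = Σ PlaneTree (λ t → (edges t ≡ n) × Valid {n} t w)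

-- k ∈ R(n,1): some word of length 2n over {A, Ā} has exactly k valid
-- plane trees (the valid trees are in bijection with Fin k).
InR : ℕ → ℕ → Set
InR n k = Σ (Vec Letter (2 * n)) (λ w → Fin k ↔ ValidTrees n w)

module Submission where

-- A w-valid tree is node cs for a forest cs parsing w, so we count the forests of words.
-- Cutting off the root edge of the first tree, the forests of A ∷ w correspond to the splits
-- w = q ++ Ā ∷ s with q of height 0, times forests of q and of s.  Consequently wrapping a
-- Dyck word U as nest j U = Aʲ U Āʲ, or putting Aᵐ Āᵐ / valley m = Āᵐ Aᵐ in front of a word
-- whose prefixes stay on one side, does not change the number of forests.  For the words
-- Aʲ U Āʲ valley m Aʲ V Āʲ the first A closes either after U or at the very end, so, writing
-- #U for the number of forests of U, count (j + 1, m) = #U · #V + count (j, m + 1), hence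
-- count (j, 0) = j · #U · #V + d whenever U valley m V has d forests for every m.  Taking (U, V) = ([], AĀAĀ), (AĀ, AĀAĀ)
-- and ([], []) yields 2j + 2 forests on 2j + 2 edges, 2j + 5 on 2j + 3 edges and 3 on 4
-- edges; nesting pads to n edges, and a word of nonzero height, such as AA Aⁿ⁻¹ Āⁿ⁻¹, has
-- no forest at all.

open import Defs
open import Axiom.UniquenessOfIdentityProofs using (module Decidable⇒UIP)
open import Data.Bool using (Bool; true; false)
open import Data.Empty using (⊥; ⊥-elim)
open import Data.Fin using (Fin)
import Data.Fin.Properties as Finₚ
open import Data.Integer using (ℤ; +_; -[1+_]; +≤+; +<+)
  renaming (_+_ to _+ℤ_; _≤_ to _≤ℤ_; _<_ to _<ℤ_; -_ to -ℤ_)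
import Data.Integer.Properties as ℤₚ
open import Data.List using (List; []; _∷_; _++_; [_]; length; map)
import Data.List.Properties as Listₚ
open import Data.Maybe using (Maybe; just)
import Data.Maybe.Properties as Maybeₚ
open import Data.Nat using (ℕ; zero; suc; _+_; _*_; _∸_; _≤_; z≤n; s≤s)
import Data.Nat.Properties as ℕₚ
open import Data.Nat.Solver using (module +-*-Solver)
open import Data.Product using (Σ; ∃; _×_; _,_; proj₁; proj₂)
open import Data.Product.Function.NonDependent.Propositional using (_×-↔_)
open import Data.Sum using (_⊎_; inj₁; inj₂)
open import Data.Sum.Function.Propositional using (_⊎-↔_)
open import Data.Unit using (⊤; tt)
open import Data.Vec using (Vec; toList) renaming ([] to []ᵥ; _∷_ to _∷ᵥ_)
import Data.Vec.Properties as Vecₚ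
open import Function.Bundles using (_↔_; mk↔ₛ′)
open import Function.Properties.Inverse using (↔-refl; ↔-sym; ↔-trans)
open import Relation.Binary.Definitions using (DecidableEquality)
open import Relation.Binary.PropositionalEquality hiding ([_])
open import Relation.Nullary using (¬_; yes; no)

open +-*-Solver using (solve; _:+_; _:*_; _:=_; con)

_≟ᴸ_ : DecidableEquality Letter
A ≟ᴸ A = yes refl
A ≟ᴸ Ā = no λ ()
Ā ≟ᴸ A = no λ ()
Ā ≟ᴸ Ā = yes refl

Complementary : Letter → Letter → Set
Complementary A Ā = ⊤
Complementary Ā A = ⊤
Complementary _ _ = ⊥

checkEdge-just⁻ : ∀ a b {m r} → checkEdge a b m ≡ just r → Complementary a b × m ≡ just r
checkEdge-just⁻ A A ()
checkEdge-just⁻ A Ā h = tt , h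
checkEdge-just⁻ Ā A h = tt , h
checkEdge-just⁻ Ā Ā ()

checkEdge-just⁺ : ∀ {a b m r} → Complementary a b → m ≡ just r → checkEdge a b m ≡ just r
checkEdge-just⁺ {A} {Ā} _ h = h
checkEdge-just⁺ {Ā} {A} _ h = h

compl : Letter → Letter
compl A = Ā
compl Ā = A

compl-involutive : ∀ a → compl (compl a) ≡ a
compl-involutive A = refl
compl-involutive Ā = refl

compl-complementary : ∀ {a b} → Complementary a b → Complementary (compl a) (compl b)
compl-complementary {A} {Ā} _ = tt
compl-complementary {Ā} {A} _ = tt

complʷ : List Letter → List Letter
complʷ = map compl

complʷ-involutive : ∀ w → complʷ (complʷ w) ≡ w
complʷ-involutive []      = refl
complʷ-involutive (a ∷ w) = cong₂ _∷_ (compl-involutive a) (complʷ-involutive w)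

++-∷-nonempty : ∀ x {a : Letter} {y} → x ++ a ∷ y ≢ []
++-∷-nonempty x eq with Listₚ.++-conicalʳ x _ eq
... | ()

record ConsParse (t : PlaneTree) (ts : List PlaneTree) (a : Letter) (w r : List Letter) : Set where
  constructor consParse
  field
    closer  : Letter
    middle  : List Letter
    subtree : validT t w ≡ just (closer ∷ middle)
    edge    : Complementary a closer
    rest    : validF ts middle ≡ just r

validF-∷⁻ : ∀ t ts a w {r} → validF (t ∷ ts) (a ∷ w) ≡ just r → ConsParse t ts a w r
validF-∷⁻ t ts a w h with validT t w in eq
... | just (b ∷ w′) with checkEdge-just⁻ a b h
...   | c , h′ = consParse b w′ eq c h′

validF-∷⁺ : ∀ t ts {a b w w′ r} → validT t w ≡ just (b ∷ w′) → Complementary a b →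
            validF ts w′ ≡ just r → validF (t ∷ ts) (a ∷ w) ≡ just r
validF-∷⁺ t ts eq c h rewrite eq = checkEdge-just⁺ c h

mutual
  validT-++ : ∀ t {w r} e → validT t w ≡ just r → validT t (w ++ e) ≡ just (r ++ e)
  validT-++ (node ts) = validF-++ ts

  validF-++ : ∀ ts {w r} e → validF ts w ≡ just r → validF ts (w ++ e) ≡ just (r ++ e)
  validF-++ []       e refl = refl
  validF-++ (t ∷ ts) {a ∷ w} e h with validF-∷⁻ t ts a w h
  ... | consParse _ _ ht c hts = validF-∷⁺ t ts (validT-++ t e ht) c (validF-++ ts e hts)

children : PlaneTree → List PlaneTree
children (node ts) = ts

validT-children : ∀ t {w r} → validF (children t) w ≡ just r → validT t w ≡ just r
validT-children (node ts) h = h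

record Consumes (ts : List PlaneTree) (w r : List Letter) : Set where
  constructor consumes
  field
    prefix : List Letter
    splits : w ≡ prefix ++ r
    parses : validF ts prefix ≡ just []

mutual
  validT-consumes : ∀ t {w r} → validT t w ≡ just r → Consumes (children t) w r
  validT-consumes (node ts) = validF-consumes ts

  validF-consumes : ∀ ts {w r} → validF ts w ≡ just r → Consumes ts w r
  validF-consumes []       refl = consumes [] refl refl
  validF-consumes (t ∷ ts) {a ∷ w} {r} h with validF-∷⁻ t ts a w h
  ... | consParse b w′ ht c hts with validT-consumes t ht | validF-consumes ts hts
  ... | consumes q₁ refl p₁ | consumes q₂ refl p₂ =
    consumes (a ∷ q₁ ++ b ∷ q₂) (cong (a ∷_) (sym (Listₚ.++-assoc q₁ (b ∷ q₂) r)))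
             (validF-∷⁺ t ts (validT-++ t (b ∷ q₂) (validT-children t p₁)) c p₂)

step : Letter → ℤ
step A = + 1
step Ā = -[1+ 0 ]

height : List Letter → ℤ
height []      = + 0
height (a ∷ w) = step a +ℤ height w

height-++ : ∀ x y → height (x ++ y) ≡ height x +ℤ height y
height-++ []      y = sym (ℤₚ.+-identityˡ (height y))
height-++ (a ∷ x) y = trans (cong (step a +ℤ_) (height-++ x y)) (sym (ℤₚ.+-assoc (step a) (height x) (height y)))

height-++-balanced : ∀ x y → height x ≡ + 0 → height (x ++ y) ≡ height y
height-++-balanced x y h = trans (height-++ x y) (trans (cong (_+ℤ height y) h) (ℤₚ.+-identityˡ (height y)))

step-complementary : ∀ {a b} → Complementary a b → ∀ x → step a +ℤ (step b +ℤ x) ≡ x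
step-complementary {A} {Ā} _ x = trans (sym (ℤₚ.+-assoc (+ 1) -[1+ 0 ] x)) (ℤₚ.+-identityˡ x)
step-complementary {Ā} {A} _ x = trans (sym (ℤₚ.+-assoc -[1+ 0 ] (+ 1) x)) (ℤₚ.+-identityˡ x)

height-Ā∷ : ∀ q → height (Ā ∷ q) ≡ + 0 → height q ≡ + 1
height-Ā∷ q h = trans (sym (step-complementary {A} {Ā} tt (height q))) (cong (+ 1 +ℤ_) h)

height-A∷ : ∀ q → height (A ∷ q) ≡ + 1 → height q ≡ + 0
height-A∷ q h = trans (sym (step-complementary {Ā} {A} tt (height q))) (cong (-[1+ 0 ] +ℤ_) h)

0<+1 : ∀ {x} → x ≡ + 1 → + 0 <ℤ x
0<+1 refl = +<+ (s≤s z≤n)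

height-complʷ : ∀ w → height (complʷ w) ≡ -ℤ height w
height-complʷ []      = refl
height-complʷ (a ∷ w) =
  trans (cong₂ _+ℤ_ (step-compl a) (height-complʷ w)) (sym (ℤₚ.neg-distrib-+ (step a) (height w)))
  where
    step-compl : ∀ a → step (compl a) ≡ -ℤ step a
    step-compl A = refl
    step-compl Ā = refl

mutual
  validT-height : ∀ t {w r} → validT t w ≡ just r → height w ≡ height r
  validT-height (node ts) = validF-height ts

  validF-height : ∀ ts {w r} → validF ts w ≡ just r → height w ≡ height r
  validF-height []       refl = refl
  validF-height (t ∷ ts) {a ∷ w} h with validF-∷⁻ t ts a w h
  ... | consParse b w′ ht c hts =
    trans (cong (step a +ℤ_) (validT-height t ht))
          (trans (step-complementary c (height w′)) (validF-height ts hts))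

mutual
  validT-length : ∀ t {w r} → validT t w ≡ just r → length w ≡ 2 * edges t + length r
  validT-length (node ts) = validF-length ts

  validF-length : ∀ ts {w r} → validF ts w ≡ just r → length w ≡ 2 * edgesF ts + length r
  validF-length []       refl = refl
  validF-length (t ∷ ts) {a ∷ w} {r} h with validF-∷⁻ t ts a w h
  ... | consParse _ _ ht _ hts rewrite validT-length t ht | validF-length ts hts =
    solve 3 (λ x y l → con 1 :+ (con 2 :* x :+ (con 1 :+ (con 2 :* y :+ l)))
                    := con 2 :* (con 1 :+ (x :+ y)) :+ l) refl (edges t) (edgesF ts) (length r)

mutual
  validT-complʷ : ∀ t {w r} → validT t w ≡ just r → validT t (complʷ w) ≡ just (complʷ r)
  validT-complʷ (node ts) = validF-complʷ ts

  validF-complʷ : ∀ ts {w r} → validF ts w ≡ just r → validF ts (complʷ w) ≡ just (complʷ r)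
  validF-complʷ []       refl = refl
  validF-complʷ (t ∷ ts) {a ∷ w} h with validF-∷⁻ t ts a w h
  ... | consParse _ _ ht c hts =
    validF-∷⁺ t ts (validT-complʷ t ht) (compl-complementary c) (validF-complʷ ts hts)

infixr 2 _⨾_
_⨾_ : ∀ {X Y Z : Set} → X ↔ Y → Y ↔ Z → X ↔ Z
_⨾_ = ↔-trans

×-⊤ : ∀ {X : Set} → (X × ⊤) ↔ X
×-⊤ = mk↔ₛ′ proj₁ (_, tt) (λ _ → refl) (λ _ → refl)

⊤-× : ∀ {X : Set} → (⊤ × X) ↔ X
⊤-× = mk↔ₛ′ proj₂ (tt ,_) (λ _ → refl) (λ _ → refl)

Σ-⊤ : ∀ {P : ⊤ → Set} → Σ ⊤ P ↔ P tt
Σ-⊤ = mk↔ₛ′ proj₂ (tt ,_) (λ _ → refl) (λ _ → refl)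

Σ-Bool : ∀ {P : Bool → Set} → Σ Bool P ↔ (P true ⊎ P false)
Σ-Bool = mk↔ₛ′ (λ { (true , x) → inj₁ x ; (false , x) → inj₂ x })
               (λ { (inj₁ x) → true , x ; (inj₂ x) → false , x })
               (λ { (inj₁ x) → refl ; (inj₂ x) → refl })
               (λ { (true , x) → refl ; (false , x) → refl })

data Three : Set where
  first second third : Three

Σ-Three : ∀ {P : Three → Set} → Σ Three P ↔ (P first ⊎ (P second ⊎ P third))
Σ-Three = mk↔ₛ′
  (λ { (first , x) → inj₁ x ; (second , x) → inj₂ (inj₁ x) ; (third , x) → inj₂ (inj₂ x) })
  (λ { (inj₁ x) → first , x ; (inj₂ (inj₁ x)) → second , x ; (inj₂ (inj₂ x)) → third , x })
  (λ { (inj₁ x) → refl ; (inj₂ (inj₁ x)) → refl ; (inj₂ (inj₂ x)) → refl })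
  (λ { (first , x) → refl ; (second , x) → refl ; (third , x) → refl })

Card : Set → ℕ → Set
Card S k = Fin k ↔ S

card-⊤ : Card ⊤ 1
card-⊤ = Finₚ.1↔⊤

card-× : ∀ {S T a b} → Card S a → Card T b → Card (S × T) (a * b)
card-× p q = Finₚ.*↔× ⨾ (p ×-↔ q)

card-⊎ : ∀ {S T a b} → Card S a → Card T b → Card (S ⊎ T) (a + b)
card-⊎ p q = Finₚ.+↔⊎ ⨾ (p ⊎-↔ q)

card-empty : ∀ {S} → ¬ S → Card S 0
card-empty ¬s = mk↔ₛ′ (λ ()) (λ s → ⊥-elim (¬s s)) (λ s → ⊥-elim (¬s s)) (λ ())

Forests : List Letter → Set
Forests w = Σ (List PlaneTree) λ ts → validF ts w ≡ just []

parse-irrelevant : ∀ {x y : Maybe (List Letter)} (p q : x ≡ y) → p ≡ q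
parse-irrelevant = Decidable⇒UIP.≡-irrelevant (Maybeₚ.≡-dec (Listₚ.≡-dec _≟ᴸ_))

Forests-≡ : ∀ {w} {x y : Forests w} → proj₁ x ≡ proj₁ y → x ≡ y
Forests-≡ {x = ts , p} {.ts , q} refl = cong (ts ,_) (parse-irrelevant p q)

Forests-cong : ∀ {w w′} → w ≡ w′ → Forests w ↔ Forests w′
Forests-cong refl = ↔-refl

Forests-height : ∀ {w} → Forests w → height w ≡ + 0
Forests-height (ts , p) = validF-height ts p

Forests-[] : Forests [] ↔ ⊤
Forests-[] = mk↔ₛ′ (λ _ → tt) (λ _ → [] , refl) (λ _ → refl) λ { ([] , refl) → refl }

card-[] : Card (Forests []) 1
card-[] = card-⊤ ⨾ ↔-sym Forests-[]

Forests-complʷ : ∀ w → Forests w ↔ Forests (complʷ w)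
Forests-complʷ w = mk↔ₛ′ to from (λ _ → Forests-≡ refl) (λ _ → Forests-≡ refl)
  where
    to : Forests w → Forests (complʷ w)
    to (ts , p) = ts , validF-complʷ ts p
    from : Forests (complʷ w) → Forests w
    from (ts , p) = ts , subst (λ v → validF ts v ≡ just []) (complʷ-involutive w) (validF-complʷ ts p)

-- The root edge of the first tree of a forest for A ∷ w closes at an Ā of w; its children
-- parse the part before that Ā (which therefore has height 0) and the other trees the rest.
module FirstEdge
  (w : List Letter) (I : Set) (before after : I → List Letter)
  (at : ∀ i → w ≡ before i ++ Ā ∷ after i)
  (after-injective : ∀ i j → after i ≡ after j → i ≡ j)
  (complete : ∀ q s → w ≡ q ++ Ā ∷ s → height q ≡ + 0 → ∃ λ i → q ≡ before i × s ≡ after i)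
  where

  Decomposition : Set
  Decomposition = Σ I λ i → Forests (before i) × Forests (after i)

  forests : Decomposition → List PlaneTree × List PlaneTree
  forests (_ , (cs , _) , (ts , _)) = cs , ts

  children-parse : ∀ i cs → validF cs (before i) ≡ just [] → validF cs w ≡ just (Ā ∷ after i)
  children-parse i cs p =
    subst (λ v → validF cs v ≡ just (Ā ∷ after i)) (sym (at i)) (validF-++ cs (Ā ∷ after i) p)

  join : Decomposition → Forests (A ∷ w)
  join (i , (cs , p) , (ts , q)) = node cs ∷ ts , validF-∷⁺ (node cs) ts (children-parse i cs p) tt q

  decompose : ∀ cs ts → validF (node cs ∷ ts) (A ∷ w) ≡ just [] →
              Σ Decomposition λ d → forests d ≡ (cs , ts)
  decompose cs ts p with validF-∷⁻ (node cs) ts A w p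
  ... | consParse Ā w′ hc _ hts with validF-consumes cs hc
  ... | consumes q w≡qĀw′ pq with complete q w′ w≡qĀw′ (validF-height cs pq)
  ... | i , refl , refl = (i , (cs , pq) , (ts , hts)) , refl

  forests-injective : ∀ d d′ → forests d ≡ forests d′ → d ≡ d′
  forests-injective (i , (cs , p) , (ts , q)) (i′ , (.cs , p′) , (.ts , q′)) refl
    with after-injective i i′
           (Listₚ.∷-injectiveʳ (Maybeₚ.just-injective
             (trans (sym (children-parse i cs p)) (children-parse i′ cs p′))))
  ... | refl = cong₂ (λ u v → i , (cs , u) , (ts , v)) (parse-irrelevant p p′) (parse-irrelevant q q′)

  first-edge : Forests (A ∷ w) ↔ Decomposition
  first-edge = mk↔ₛ′ split join split∘join join∘split
    where
      split : Forests (A ∷ w) → Decomposition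
      split (node cs ∷ ts , p) = proj₁ (decompose cs ts p)

      split∘join : ∀ d → split (join d) ≡ d
      split∘join d@(i , (cs , p) , (ts , q)) = forests-injective _ d (proj₂ (decompose cs ts _))

      join∘split : ∀ x → join (split x) ≡ x
      join∘split (node cs ∷ ts , p) with decompose cs ts p
      ... | _ , e = Forests-≡ (cong (λ (cs , ts) → node cs ∷ ts) e)

first-edge-unique : ∀ {w q s} → w ≡ q ++ Ā ∷ s →
  (∀ q′ s′ → w ≡ q′ ++ Ā ∷ s′ → height q′ ≡ + 0 → q′ ≡ q × s′ ≡ s) →
  Forests (A ∷ w) ↔ (Forests q × Forests s)
first-edge-unique {w} {q} {s} at unique =
  FirstEdge.first-edge w ⊤ (λ _ → q) (λ _ → s) (λ _ → at) (λ _ _ _ → refl)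
                       (λ q′ s′ e h → tt , unique q′ s′ e h)
  ⨾ Σ-⊤

first-edge-two : ∀ {w q₁ s₁ q₂ s₂} → w ≡ q₁ ++ Ā ∷ s₁ → w ≡ q₂ ++ Ā ∷ s₂ → s₁ ≢ s₂ →
  (∀ q s → w ≡ q ++ Ā ∷ s → height q ≡ + 0 → (q ≡ q₁ × s ≡ s₁) ⊎ (q ≡ q₂ × s ≡ s₂)) →
  Forests (A ∷ w) ↔ ((Forests q₁ × Forests s₁) ⊎ (Forests q₂ × Forests s₂))
first-edge-two {w} {q₁} {s₁} {q₂} {s₂} at₁ at₂ s₁≢s₂ complete =
  FirstEdge.first-edge w Bool before after at after-injective complete′ ⨾ Σ-Bool
  where
    before after : Bool → List Letter
    before true  = q₁
    before false = q₂
    after true  = s₁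
    after false = s₂
    at : ∀ i → w ≡ before i ++ Ā ∷ after i
    at true  = at₁
    at false = at₂
    after-injective : ∀ i j → after i ≡ after j → i ≡ j
    after-injective true  true  _ = refl
    after-injective false false _ = refl
    after-injective true  false e = ⊥-elim (s₁≢s₂ e)
    after-injective false true  e = ⊥-elim (s₁≢s₂ (sym e))
    complete′ : ∀ q s → w ≡ q ++ Ā ∷ s → height q ≡ + 0 → ∃ λ i → q ≡ before i × s ≡ after i
    complete′ q s e h with complete q s e h
    ... | inj₁ p = true , p
    ... | inj₂ p = false , p

NonNegPrefixes NonPosPrefixes : List Letter → Set
NonNegPrefixes x = ∀ p s → x ≡ p ++ s → + 0 ≤ℤ height p
NonPosPrefixes x = ∀ p s → x ≡ p ++ s → height p ≤ℤ + 0

Dyck CoDyck : List Letter → Set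
Dyck x   = NonNegPrefixes x × height x ≡ + 0
CoDyck x = NonPosPrefixes x × height x ≡ + 0

++-split : ∀ (x y p s : List Letter) → x ++ y ≡ p ++ s →
  (∃ λ p′ → p ≡ x ++ p′ × y ≡ p′ ++ s) ⊎ (∃ λ c → ∃ λ s′ → x ≡ p ++ c ∷ s′ × s ≡ c ∷ s′ ++ y)
++-split []      y p       s e = inj₁ (p , refl , e)
++-split (a ∷ x) y []      s e = inj₂ (a , x , refl , sym e)
++-split (a ∷ x) y (b ∷ p) s e with Listₚ.∷-injective e
... | refl , e′ with ++-split x y p s e′
...   | inj₁ (p′ , refl , e″)    = inj₁ (p′ , refl , e″)
...   | inj₂ (c , s′ , refl , e″) = inj₂ (c , s′ , refl , e″)

prefix-∷ʳ-Ā-negative : ∀ q → height q ≤ℤ + 0 → + 0 ≤ℤ height (q ++ [ Ā ]) → ⊥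
prefix-∷ʳ-Ā-negative q h≤0 h≥0 = absurd (height q) h≤0 (subst (+ 0 ≤ℤ_) (height-++ q [ Ā ]) h≥0)
  where
    absurd : ∀ x → x ≤ℤ + 0 → + 0 ≤ℤ x +ℤ -[1+ 0 ] → ⊥
    absurd (+ zero)  _         ()
    absurd (+ suc n) (+≤+ ()) _
    absurd -[1+ n ]  _         ()

-- Splitting u ++ r at an Ā whose prefix q has height ≤ 0: the split cannot fall inside
-- u, since then q ++ [ Ā ] would be a prefix of u of negative height.
dyck-split : ∀ {u r q s} → Dyck u → u ++ r ≡ q ++ Ā ∷ s → height q ≤ℤ + 0 →
             ∃ λ q′ → q ≡ u ++ q′ × r ≡ q′ ++ Ā ∷ s × height q′ ≡ height q
dyck-split {u} {r} {q} {s} (nonNeg , balanced) e h≤0 with ++-split u r q (Ā ∷ s) e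
... | inj₁ (q′ , refl , e′) = q′ , refl , e′ , sym (height-++-balanced u q′ balanced)
... | inj₂ (_ , s′ , refl , refl) =
  ⊥-elim (prefix-∷ʳ-Ā-negative q h≤0 (nonNeg (q ++ [ Ā ]) s′ (sym (Listₚ.++-assoc q [ Ā ] s′))))

coDyck-split : ∀ {v r q s} → CoDyck v → v ++ r ≡ q ++ Ā ∷ s → + 0 <ℤ height q →
               ∃ λ q′ → q ≡ v ++ q′ × r ≡ q′ ++ Ā ∷ s × height q′ ≡ height q
coDyck-split {v} {r} {q} {s} (nonPos , balanced) e 0<h with ++-split v r q (Ā ∷ s) e
... | inj₁ (q′ , refl , e′)      = q′ , refl , e′ , sym (height-++-balanced v q′ balanced)
... | inj₂ (c , s′ , refl , _) = ⊥-elim (ℤₚ.<⇒≱ 0<h (nonPos q (c ∷ s′) refl))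

dyck-[] : Dyck []
dyck-[] = (λ { [] _ _ → +≤+ z≤n }) , refl

dyck-++ : ∀ {x y} → Dyck x → Dyck y → Dyck (x ++ y)
dyck-++ {x} {y} (nx , hx) (ny , hy) = nonNeg , trans (height-++-balanced x y hx) hy
  where
    nonNeg : NonNegPrefixes (x ++ y)
    nonNeg p s e with ++-split x y p s e
    ... | inj₁ (p′ , refl , e′)      = subst (+ 0 ≤ℤ_) (sym (height-++-balanced x p′ hx)) (ny p′ s e′)
    ... | inj₂ (c , s′ , refl , _) = nx p (c ∷ s′) refl

dyck-wrap : ∀ {D} → Dyck D → Dyck (A ∷ D ++ [ Ā ])
dyck-wrap {D} (nD , hD) = nonNeg , cong (+ 1 +ℤ_) (height-++-balanced D [ Ā ] hD)
  where
    1+nonNeg : ∀ x → + 0 ≤ℤ x → + 0 ≤ℤ + 1 +ℤ x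
    1+nonNeg (+ _)    _  = +≤+ z≤n
    1+nonNeg -[1+ _ ] ()

    ending : ∀ p′ {s} → [ Ā ] ≡ p′ ++ s → + 0 ≤ℤ + 1 +ℤ height p′
    ending []          _  = +≤+ z≤n
    ending (Ā ∷ [])    _  = +≤+ z≤n
    ending (Ā ∷ _ ∷ _) ()
    ending (A ∷ _)     ()

    nonNeg : NonNegPrefixes (A ∷ D ++ [ Ā ])
    nonNeg []      _ _ = +≤+ z≤n
    nonNeg (a ∷ p) s e with Listₚ.∷-injective e
    ... | refl , e′ with ++-split D [ Ā ] p s e′
    ...   | inj₂ (c , s′ , refl , _) = 1+nonNeg (height p) (nD p (c ∷ s′) refl)
    ...   | inj₁ (p′ , refl , e″) =
      subst (λ h → + 0 ≤ℤ + 1 +ℤ h) (sym (height-++-balanced D p′ hD)) (ending p′ e″)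

nonNeg-complʷ : ∀ {x} → NonNegPrefixes x → NonPosPrefixes (complʷ x)
nonNeg-complʷ {x} nonNeg p s e = subst (_≤ℤ + 0) (ℤₚ.neg-involutive (height p)) (ℤₚ.neg-mono-≤ 0≤-h)
  where
    x-split : x ≡ complʷ p ++ complʷ s
    x-split = trans (sym (complʷ-involutive x)) (trans (cong complʷ e) (Listₚ.map-++ compl p s))
    0≤-h : + 0 ≤ℤ -ℤ height p
    0≤-h = subst (+ 0 ≤ℤ_) (height-complʷ p) (nonNeg (complʷ p) (complʷ s) x-split)

dyck-complʷ : ∀ {x} → Dyck x → CoDyck (complʷ x)
dyck-complʷ {x} (nonNeg , balanced) = nonNeg-complʷ nonNeg , trans (height-complʷ x) (cong -ℤ_ balanced)

nest : ℕ → List Letter → List Letter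
nest zero    U = U
nest (suc j) U = A ∷ nest j U ++ [ Ā ]

valley : ℕ → List Letter
valley m = complʷ (nest m [])

dyck-nest : ∀ j {U} → Dyck U → Dyck (nest j U)
dyck-nest zero    d = d
dyck-nest (suc j) d = dyck-wrap (dyck-nest j d)

coDyck-valley : ∀ m → CoDyck (valley m)
coDyck-valley m = dyck-complʷ (dyck-nest m dyck-[])

valley-suc-++ : ∀ m z → valley (suc m) ++ z ≡ Ā ∷ valley m ++ A ∷ z
valley-suc-++ m z =
  cong (Ā ∷_) (trans (cong (_++ z) (Listₚ.map-++ compl (nest m []) [ Ā ])) (Listₚ.++-assoc (valley m) [ A ] z))

length-nest : ∀ j U → length (nest j U) ≡ 2 * j + length U
length-nest zero    U = refl
length-nest (suc j) U = begin
  length (nest (suc j) U)      ≡⟨ cong suc (Listₚ.length-++ (nest j U)) ⟩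
  suc (length (nest j U) + 1)  ≡⟨ cong (λ l → suc (l + 1)) (length-nest j U) ⟩
  suc (2 * j + length U + 1)   ≡⟨ solve 2 (λ j u → con 1 :+ (con 2 :* j :+ u :+ con 1)
                                                 := con 2 :* (con 1 :+ j) :+ u) refl j (length U) ⟩
  2 * suc j + length U         ∎
  where open ≡-Reasoning

Forests-wrap : ∀ {D} → Dyck D → Forests (A ∷ D ++ [ Ā ]) ↔ Forests D
Forests-wrap {D} d = first-edge-unique refl unique ⨾ (↔-refl ×-↔ Forests-[]) ⨾ ×-⊤
  where
    unique : ∀ q s → D ++ [ Ā ] ≡ q ++ Ā ∷ s → height q ≡ + 0 → q ≡ D × s ≡ []
    unique q s e h with dyck-split d e (ℤₚ.≤-reflexive h)
    ... | []     , q≡D++[] , refl , _ = trans q≡D++[] (Listₚ.++-identityʳ D) , refl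
    ... | _ ∷ q′ , _       , e′   , _ = ⊥-elim (++-∷-nonempty q′ (sym (Listₚ.∷-injectiveʳ e′)))

Forests-nest : ∀ j {U} → Dyck U → Forests (nest j U) ↔ Forests U
Forests-nest zero    _ = ↔-refl
Forests-nest (suc j) d = Forests-wrap (dyck-nest j d) ⨾ Forests-nest j d

Forests-peak-++ : ∀ m {Z} → NonPosPrefixes Z → Forests (nest m [] ++ Z) ↔ Forests Z
Forests-peak-++ zero    _ = ↔-refl
Forests-peak-++ (suc m) {Z} nonPos =
  Forests-cong (cong (A ∷_) (Listₚ.++-assoc X [ Ā ] Z)) ⨾ first-edge-unique refl unique
  ⨾ ((Forests-nest m dyck-[] ⨾ Forests-[]) ×-↔ ↔-refl) ⨾ ⊤-×
  where
    X = nest m []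

    unique : ∀ q s → X ++ Ā ∷ Z ≡ q ++ Ā ∷ s → height q ≡ + 0 → q ≡ X × s ≡ Z
    unique q s e h with dyck-split (dyck-nest m dyck-[]) e (ℤₚ.≤-reflexive h)
    ... | []      , q≡X++[] , e′ , _  = trans q≡X++[] (Listₚ.++-identityʳ X) , sym (Listₚ.∷-injectiveʳ e′)
    ... | A ∷ _   , _       , () , _
    ... | Ā ∷ q′  , _       , e′ , h′ =
      ⊥-elim (1≰0 (subst (_≤ℤ + 0) (height-Ā∷ q′ (trans h′ h)) (nonPos q′ (Ā ∷ s) (Listₚ.∷-injectiveʳ e′))))
      where
        1≰0 : ¬ (+ 1 ≤ℤ + 0)
        1≰0 (+≤+ ())

Forests-valley-++ : ∀ m {Y} → NonNegPrefixes Y → Forests (valley m ++ Y) ↔ Forests Y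
Forests-valley-++ m {Y} nonNeg =
  Forests-complʷ (valley m ++ Y) ⨾ Forests-cong complʷ-split
  ⨾ Forests-peak-++ m (nonNeg-complʷ nonNeg) ⨾ ↔-sym (Forests-complʷ Y)
  where
    complʷ-split : complʷ (valley m ++ Y) ≡ nest m [] ++ complʷ Y
    complʷ-split = trans (Listₚ.map-++ compl (valley m) Y) (cong (_++ complʷ Y) (complʷ-involutive (nest m [])))

AĀ ĀA AĀAĀ : List Letter
AĀ   = A ∷ Ā ∷ []
ĀA   = Ā ∷ A ∷ []
AĀAĀ = A ∷ Ā ∷ A ∷ Ā ∷ []

dyck-AĀ : Dyck AĀ
dyck-AĀ = dyck-nest 1 dyck-[]

dyck-AĀAĀ : Dyck AĀAĀ
dyck-AĀAĀ = dyck-++ dyck-AĀ dyck-AĀ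

card-AĀ : Card (Forests AĀ) 1
card-AĀ = card-[] ⨾ ↔-sym (Forests-nest 1 dyck-[])

card-ĀA : Card (Forests ĀA) 1
card-ĀA = card-AĀ ⨾ Forests-complʷ AĀ

card-AĀAĀ : Card (Forests AĀAĀ) 2
card-AĀAĀ =
  card-⊎ (card-× card-[] card-AĀ) (card-× card-ĀA card-[]) ⨾ ↔-sym (first-edge-two refl refl (λ ()) complete)
  where
    complete : ∀ q s → Ā ∷ A ∷ Ā ∷ [] ≡ q ++ Ā ∷ s → height q ≡ + 0 → (q ≡ [] × s ≡ AĀ) ⊎ (q ≡ ĀA × s ≡ [])
    complete []                    _ refl _ = inj₁ (refl , refl)
    complete (Ā ∷ A ∷ [])          _ refl _ = inj₂ (refl , refl)
    complete (A ∷ _)               _ ()   _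
    complete (Ā ∷ [])              _ ()   _
    complete (Ā ∷ Ā ∷ _)           _ ()   _
    complete (Ā ∷ A ∷ A ∷ _)       _ ()   _
    complete (Ā ∷ A ∷ Ā ∷ [])      _ ()   _
    complete (Ā ∷ A ∷ Ā ∷ _ ∷ _)   _ ()   _

card-valley : ∀ m → Card (Forests (valley m ++ [])) 1
card-valley m = card-[] ⨾ ↔-sym (Forests-valley-++ m (proj₁ dyck-[]))

card-valley-AĀAĀ : ∀ m → Card (Forests (valley m ++ AĀAĀ)) 2
card-valley-AĀAĀ m = card-AĀAĀ ⨾ ↔-sym (Forests-valley-++ m (proj₁ dyck-AĀAĀ))

card-peak-AĀ : ∀ m → Card (Forests (nest (suc m) [] ++ AĀ)) 2
card-peak-AĀ m =
  card-⊎ (card-× card-X card-AĀ) (card-× card-XĀA card-[])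
  ⨾ ↔-sym (Forests-cong (cong (A ∷_) (Listₚ.++-assoc X [ Ā ] AĀ))
           ⨾ first-edge-two refl (sym (Listₚ.++-assoc X ĀA [ Ā ])) (λ ()) complete)
  where
    X = nest m []

    card-X : Card (Forests X) 1
    card-X = card-[] ⨾ ↔-sym (Forests-nest m dyck-[])

    card-XĀA : Card (Forests (X ++ ĀA)) 1
    card-XĀA = card-ĀA ⨾ ↔-sym (Forests-peak-++ m (proj₁ (coDyck-valley 1)))

    complete : ∀ q s → X ++ Ā ∷ AĀ ≡ q ++ Ā ∷ s → height q ≡ + 0 →
               (q ≡ X × s ≡ AĀ) ⊎ (q ≡ X ++ ĀA × s ≡ [])
    complete q s e h with dyck-split (dyck-nest m dyck-[]) e (ℤₚ.≤-reflexive h)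
    ... | []                , q≡X++[] , refl , _ = inj₁ (trans q≡X++[] (Listₚ.++-identityʳ X) , refl)
    ... | Ā ∷ A ∷ []        , q≡X++ĀA , refl , _ = inj₂ (q≡X++ĀA , refl)
    ... | A ∷ _             , _ , () , _
    ... | Ā ∷ []            , _ , () , _
    ... | Ā ∷ Ā ∷ _         , _ , () , _
    ... | Ā ∷ A ∷ A ∷ _     , _ , () , _
    ... | Ā ∷ A ∷ Ā ∷ []    , _ , () , _
    ... | Ā ∷ A ∷ Ā ∷ _ ∷ _ , _ , () , _

card-AĀ-valley-AĀAĀ : ∀ m → Card (Forests (AĀ ++ valley m ++ AĀAĀ)) 5
card-AĀ-valley-AĀAĀ m =
  card-⊎ (card-× card-[] (card-valley-AĀAĀ m))
         (card-⊎ (card-× card-valley-suc card-AĀ) (card-× card-valley-suc-ĀA card-[]))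
  ⨾ ↔-sym (FirstEdge.first-edge (Ā ∷ N ++ AĀAĀ) Three before after at after-injective complete ⨾ Σ-Three)
  where
    N = valley m

    before after : Three → List Letter
    before first  = []
    before second = Ā ∷ N ++ [ A ]
    before third  = Ā ∷ N ++ A ∷ ĀA
    after first  = N ++ AĀAĀ
    after second = AĀ
    after third  = []

    at : ∀ i → Ā ∷ N ++ AĀAĀ ≡ before i ++ Ā ∷ after i
    at first  = refl
    at second = cong (Ā ∷_) (sym (Listₚ.++-assoc N [ A ] (Ā ∷ AĀ)))
    at third  = cong (Ā ∷_) (sym (Listₚ.++-assoc N (A ∷ ĀA) [ Ā ]))

    ++-AĀAĀ≢AĀ : ∀ x → x ++ AĀAĀ ≢ AĀ
    ++-AĀAĀ≢AĀ []              ()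
    ++-AĀAĀ≢AĀ (_ ∷ [])        ()
    ++-AĀAĀ≢AĀ (_ ∷ _ ∷ [])    ()
    ++-AĀAĀ≢AĀ (_ ∷ _ ∷ _ ∷ _) ()

    after-injective : ∀ i j → after i ≡ after j → i ≡ j
    after-injective first  first  _ = refl
    after-injective second second _ = refl
    after-injective third  third  _ = refl
    after-injective first  second e = ⊥-elim (++-AĀAĀ≢AĀ N e)
    after-injective second first  e = ⊥-elim (++-AĀAĀ≢AĀ N (sym e))
    after-injective first  third  e = ⊥-elim (++-∷-nonempty N e)
    after-injective third  first  e = ⊥-elim (++-∷-nonempty N (sym e))
    after-injective second third  ()
    after-injective third  second ()

    complete : ∀ q s → Ā ∷ N ++ AĀAĀ ≡ q ++ Ā ∷ s → height q ≡ + 0 → ∃ λ i → q ≡ before i × s ≡ after i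
    complete []       s e _ = first , refl , sym (Listₚ.∷-injectiveʳ e)
    complete (A ∷ _)  s () _
    complete (Ā ∷ q₁) s e h
      with coDyck-split (coDyck-valley m) (Listₚ.∷-injectiveʳ e) (0<+1 (height-Ā∷ q₁ h))
    ... | A ∷ []                , refl , refl , _ = second , refl , refl
    ... | A ∷ Ā ∷ A ∷ []        , refl , refl , _ = third , refl , refl
    ... | []                    , _ , () , _
    ... | Ā ∷ _                 , _ , () , _
    ... | A ∷ A ∷ _             , _ , () , _
    ... | A ∷ Ā ∷ []            , _ , () , _
    ... | A ∷ Ā ∷ Ā ∷ _         , _ , () , _
    ... | A ∷ Ā ∷ A ∷ _ ∷ []    , _ , () , _
    ... | A ∷ Ā ∷ A ∷ _ ∷ _ ∷ _ , _ , () , _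

    card-valley-suc : Card (Forests (Ā ∷ N ++ [ A ])) 1
    card-valley-suc = card-valley (suc m) ⨾ Forests-cong (valley-suc-++ m [])

    card-valley-suc-ĀA : Card (Forests (Ā ∷ N ++ A ∷ ĀA)) 2
    card-valley-suc-ĀA = card-peak-AĀ m ⨾ Forests-complʷ (nest (suc m) [] ++ AĀ) ⨾ Forests-cong complʷ-split
      where
        complʷ-split : complʷ (nest (suc m) [] ++ AĀ) ≡ Ā ∷ N ++ A ∷ ĀA
        complʷ-split = trans (Listₚ.map-++ compl (nest (suc m) []) AĀ) (valley-suc-++ m ĀA)

record Realizes (n k : ℕ) : Set where
  constructor realizes
  field
    witness        : List Letter
    witness-length : length witness ≡ 2 * n
    witness-card   : Card (Forests witness) k

realizes-nest : ∀ {W s k n} → Dyck W → length W ≡ 2 * s → Card (Forests W) k → s ≤ n → Realizes n k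
realizes-nest {W} {s} {n = n} dW len c s≤n =
  realizes (nest (n ∸ s) W) length-nested (c ⨾ ↔-sym (Forests-nest (n ∸ s) dW))
  where
    open ≡-Reasoning
    length-nested : length (nest (n ∸ s) W) ≡ 2 * n
    length-nested = begin
      length (nest (n ∸ s) W) ≡⟨ length-nest (n ∸ s) W ⟩
      2 * (n ∸ s) + length W  ≡⟨ cong (_+_ (2 * (n ∸ s))) len ⟩
      2 * (n ∸ s) + 2 * s     ≡⟨ sym (ℕₚ.*-distribˡ-+ 2 (n ∸ s) s) ⟩
      2 * (n ∸ s + s)         ≡⟨ cong (2 *_) (ℕₚ.m∸n+n≡m s≤n) ⟩
      2 * n                   ∎

module Chain (U V : List Letter) (dU : Dyck U) (dV : Dyck V) where

  word : ℕ → ℕ → List Letter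
  word j m = nest j U ++ valley m ++ nest j V

  -- The first A is closed either by the Ā ending nest (suc j) U or by the final Ā.
  Forests-word-suc : ∀ j m → Forests (word (suc j) m) ↔ ((Forests U × Forests V) ⊎ Forests (word j (suc m)))
  Forests-word-suc j m =
    Forests-cong (cong (A ∷_) (Listₚ.++-assoc Xu [ Ā ] R))
    ⨾ first-edge-two refl at-last (++-∷-nonempty (valley m)) complete
    ⨾ ((Forests-nest j dU ×-↔ (Forests-valley-++ m (proj₁ (dyck-nest (suc j) dV)) ⨾ Forests-nest (suc j) dV))
       ⊎-↔ ((Forests-cong last≡word ×-↔ Forests-[]) ⨾ ×-⊤))
    where
      Xu = nest j U
      Xv = nest j V
      R = valley m ++ A ∷ Xv ++ [ Ā ]
      last = Xu ++ Ā ∷ valley m ++ A ∷ Xv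

      at-last : Xu ++ Ā ∷ R ≡ last ++ Ā ∷ []
      at-last = sym (trans (Listₚ.++-assoc Xu (Ā ∷ valley m ++ A ∷ Xv) [ Ā ])
                           (cong (λ z → Xu ++ Ā ∷ z) (Listₚ.++-assoc (valley m) (A ∷ Xv) [ Ā ])))

      last≡word : last ≡ word j (suc m)
      last≡word = cong (Xu ++_) (sym (valley-suc-++ m Xv))

      complete : ∀ q s → Xu ++ Ā ∷ R ≡ q ++ Ā ∷ s → height q ≡ + 0 → (q ≡ Xu × s ≡ R) ⊎ (q ≡ last × s ≡ [])
      complete q s e h with dyck-split (dyck-nest j dU) e (ℤₚ.≤-reflexive h)
      ... | []     , q≡Xu++[] , e₁ , _ =
        inj₁ (trans q≡Xu++[] (Listₚ.++-identityʳ Xu) , sym (Listₚ.∷-injectiveʳ e₁))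
      ... | A ∷ _  , _        , () , _
      ... | Ā ∷ q₁ , refl     , e₁ , h₁
        with height-Ā∷ q₁ (trans h₁ h)
      ...   | h₁≡1 with coDyck-split (coDyck-valley m) (Listₚ.∷-injectiveʳ e₁) (0<+1 h₁≡1)
      ...     | []      , _    , () , _
      ...     | Ā ∷ _   , _    , () , _
      ...     | A ∷ q₂  , refl , e₂ , h₂
        with dyck-split (dyck-nest j dV) (Listₚ.∷-injectiveʳ e₂) (ℤₚ.≤-reflexive (height-A∷ q₂ (trans h₂ h₁≡1)))
      ...       | []     , refl , refl , _ =
                    inj₂ (cong (λ z → Xu ++ Ā ∷ valley m ++ A ∷ z) (Listₚ.++-identityʳ Xv) , refl)
      ...       | _ ∷ q₃ , _    , e₃   , _ = ⊥-elim (++-∷-nonempty q₃ (sym (Listₚ.∷-injectiveʳ e₃)))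

  card-word : ∀ j {cu cv d} → Card (Forests U) cu → Card (Forests V) cv →
              (∀ m → Card (Forests (U ++ valley m ++ V)) d) →
              ∀ m → Card (Forests (word j m)) (j * (cu * cv) + d)
  card-word zero    _  _  cd m = cd m
  card-word (suc j) {cu} {cv} {d} cU cV cd m =
    subst (Card (Forests (word (suc j) m))) (sym (ℕₚ.+-assoc (cu * cv) (j * (cu * cv)) d))
          (card-⊎ (card-× cU cV) (card-word j cU cV cd (suc m)) ⨾ ↔-sym (Forests-word-suc j m))

  realizes-word : ∀ j {s cu cv d n} → length U + length V ≡ 2 * s →
                  Card (Forests U) cu → Card (Forests V) cv → (∀ m → Card (Forests (U ++ valley m ++ V)) d) →
                  j * 2 + s ≤ n → Realizes n (j * (cu * cv) + d)
  realizes-word j {s} len cU cV cd =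
    realizes-nest (dyck-++ (dyck-nest j dU) (dyck-nest j dV)) length-word (card-word j cU cV cd 0)
    where
      open ≡-Reasoning
      length-word : length (word j 0) ≡ 2 * (j * 2 + s)
      length-word = begin
        length (nest j U ++ nest j V)          ≡⟨ Listₚ.length-++ (nest j U) ⟩
        length (nest j U) + length (nest j V)  ≡⟨ cong₂ _+_ (length-nest j U) (length-nest j V) ⟩
        2 * j + length U + (2 * j + length V)  ≡⟨ arrange j (length U) (length V) ⟩
        4 * j + (length U + length V)          ≡⟨ cong (_+_ (4 * j)) len ⟩
        4 * j + 2 * s                          ≡⟨ solve 2 (λ j s → con 4 :* j :+ con 2 :* s
                                                                := con 2 :* (j :* con 2 :+ s)) refl j s ⟩
        2 * (j * 2 + s)                        ∎
        where
          arrange : ∀ j u v → 2 * j + u + (2 * j + v) ≡ 4 * j + (u + v)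
          arrange = solve 3 (λ j u v → con 2 :* j :+ u :+ (con 2 :* j :+ v) := con 4 :* j :+ (u :+ v)) refl

realizes-0 : ∀ n → Realizes (suc n) 0
realizes-0 n = realizes (A ∷ A ∷ nest n []) length≡ (card-empty unbalanced)
  where
    length≡ : length (A ∷ A ∷ nest n []) ≡ 2 * suc n
    length≡ = trans (cong (_+_ 2) (length-nest n []))
                    (solve 1 (λ n → con 2 :+ (con 2 :* n :+ con 0) := con 2 :* (con 1 :+ n)) refl n)
    height≡2 : height (A ∷ A ∷ nest n []) ≡ + 2
    height≡2 = cong (λ h → + 1 +ℤ (+ 1 +ℤ h)) (proj₂ (dyck-nest n dyck-[]))
    unbalanced : ¬ Forests (A ∷ A ∷ nest n [])
    unbalanced f with trans (sym height≡2) (Forests-height f)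
    ... | ()

data Shape : ℕ → Set where
  is0    : Shape 0
  is1    : Shape 1
  is3    : Shape 3
  isEven : ∀ j → Shape (j * 2 + 2)
  isOdd  : ∀ j → Shape (j * 2 + 5)

shape : ∀ k → Shape k
shape zero          = is0
shape (suc zero)    = is1
shape (suc (suc k)) with shape k
... | is0      = isEven 0
... | is1      = is3
... | is3      = isOdd 0
... | isEven j = isEven (suc j)
... | isOdd j  = isOdd (suc j)

realizable : ∀ n → 4 ≤ n → ∀ k → k ≤ n → Realizes n k
realizable n 4≤n k k≤n with shape k
realizable (suc n) _ _ _ | is0 = realizes-0 n
realizable n _ _ _ | is1 = realizes-nest dyck-[] refl card-[] z≤n
realizable n 4≤n _ _ | is3 =
  Chain.realizes-word [] [] dyck-[] dyck-[] 2 {s = 0} refl card-[] card-[] card-valley 4≤n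
realizable n _ _ k≤n | isEven j =
  Chain.realizes-word [] AĀAĀ dyck-[] dyck-AĀAĀ j {s = 2} refl card-[] card-AĀAĀ card-valley-AĀAĀ k≤n
realizable n _ _ k≤n | isOdd j =
  Chain.realizes-word AĀ AĀAĀ dyck-AĀ dyck-AĀAĀ j {s = 3} refl card-AĀ card-AĀAĀ card-AĀ-valley-AĀAĀ
    (ℕₚ.≤-trans (ℕₚ.+-monoʳ-≤ (j * 2) (s≤s (s≤s (s≤s z≤n)))) k≤n)

validTrees↔Forests : ∀ n (w : Vec Letter (2 * n)) → ValidTrees n w ↔ Forests (toList w)
validTrees↔Forests n w = mk↔ₛ′ to from (λ _ → refl) from∘to
  where
    edges≡n : ∀ {cs} → validF cs (toList w) ≡ just [] → edgesF cs ≡ n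
    edges≡n {cs} p = ℕₚ.*-cancelˡ-≡ (edgesF cs) n 2
      (trans (sym (trans (validF-length cs p) (ℕₚ.+-identityʳ _))) (Vecₚ.length-toList w))
    to : ValidTrees n w → Forests (toList w)
    to (node cs , _ , p) = cs , p
    from : Forests (toList w) → ValidTrees n w
    from (cs , p) = node cs , edges≡n p , p
    from∘to : ∀ t → from (to t) ≡ t
    from∘to (node cs , e , p) = cong (λ e → node cs , e , p) (ℕₚ.≡-irrelevant _ _)

vec-of-length : ∀ (L : List Letter) {m} → length L ≡ m → Σ (Vec Letter m) λ w → toList w ≡ L
vec-of-length []      refl = []ᵥ , refl
vec-of-length (a ∷ L) refl with vec-of-length L refl
... | w , e = a ∷ᵥ w , cong (a ∷_) e

mainTheorem14 : (n : ℕ) → 4 ≤ n → (k : ℕ) → k ≤ n → InR n k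
mainTheorem14 n 4≤n k k≤n with realizable n 4≤n k k≤n
... | realizes L length-L card-L with vec-of-length L length-L
... | w , refl = w , (card-L ⨾ ↔-sym (validTrees↔Forests n w))
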